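{- The rule $I_{p3}$ is derivable in $ALFA_I$: for all graphs $A,B$, $\langle A\vee B\rangle\vdash_{ALFA_I}\langle [A]\Rightarrow B\rangle$.
   Context: Graphs of $ALFA_I$: the empty graph $\emptyset$ and propositional letters are graphs; if $G,H$ are graphs then so are the juxtaposition $GH$, the cut $[G]$ ($G$ inside a solid closed curve), the implication graph $\langle G\Rightarrow H\rangle$ (a solid closed curve containing $G$ and a dotted closed curve containing $H$), and the disjunction graph $\langle G\vee H\rangle$ (a solid closed curve containing two semi-dotted closed curves, one containing $G$ and one containing $H$; $\langle G\vee H\rangle=\langle H\vee G\rangle$). Juxtaposition is associative and commutative with unit $\emptyset$; $[\,]$ is the empty cut. Rules are schemata with $A,B,C$ arbitrary (possibly empty) graphs, applied to the whole graph on the sheet. First-degree rules: $I_\vee: A\vdash\langle A\vee B\rangle$; $I_\neg: [A]\vdash\langle A\Rightarrow[\,]\rangle$; $R_2: AB\vdash A$; $E_\neg:\langle A\Rightarrow[\,]\rangle\vdash[A]$; $MP_i: A\langle A\Rightarrow B\rangle\vdash B$; $E_\bot: [\,]\vdash A$. Second-degree rules: $R_{8i}$: if $AB\vdash C$ then $A\vdash\langle B\Rightarrow C\rangle$; $R_0$: if $A\vdash B$ and $A\vdash C$ then $A\vdash BC$; $E_\vee$: if $A\vdash C$ and $B\vdash C$ then $\langle A\vee B\rangle\vdash C$. $\vdash_{ALFA_I}$ is the least transitive relation on graphs containing all instances of the first-degree rules and closed under the second-degree rules. -}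

module Defs where

open import Data.Nat using (ℕ)

data Graph : Set where
  ∅     : Graph
  letter : ℕ → Graph
  _·_   : Graph → Graph → Graph
  cut   : Graph → Graph
  ⟨_⇒_⟩ : Graph → Graph → Graph
  ⟨_∨_⟩ : Graph → Graph → Graph

infixl 6 _·_

emptyCut : Graph
emptyCut = cut ∅

data _≈_ : Graph → Graph → Set where
  ≈-refl  : ∀ {G} → G ≈ G
  ≈-sym   : ∀ {G H} → G ≈ H → H ≈ G
  ≈-trans : ∀ {G H K} → G ≈ H → H ≈ K → G ≈ K
  ·-assoc : ∀ {G H K} → ((G · H) · K) ≈ (G · (H · K))
  ·-comm  : ∀ {G H} → (G · H) ≈ (H · G)
  ·-unit  : ∀ {G} → (∅ · G) ≈ G
  ∨-comm  : ∀ {G H} → ⟨ G ∨ H ⟩ ≈ ⟨ H ∨ G ⟩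
  ·-cong  : ∀ {G G' H H'} → G ≈ G' → H ≈ H' → (G · H) ≈ (G' · H')
  cut-cong : ∀ {G G'} → G ≈ G' → cut G ≈ cut G'
  ⇒-cong  : ∀ {G G' H H'} → G ≈ G' → H ≈ H' → ⟨ G ⇒ H ⟩ ≈ ⟨ G' ⇒ H' ⟩
  ∨-cong  : ∀ {G G' H H'} → G ≈ G' → H ≈ H' → ⟨ G ∨ H ⟩ ≈ ⟨ G' ∨ H' ⟩

infix 4 _≈_ _⊢_

-- ⊢_{ALFA_I}: least transitive relation containing all instances of the
-- first-degree rules and closed under the second-degree rules (graphs being
-- taken up to the identification _≈_).
data _⊢_ : Graph → Graph → Set where
  same  : ∀ {G H} → G ≈ H → G ⊢ H
  trans : ∀ {G H K} → G ⊢ H → H ⊢ K → G ⊢ K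
  I∨    : ∀ {A B} → A ⊢ ⟨ A ∨ B ⟩
  I¬    : ∀ {A} → cut A ⊢ ⟨ A ⇒ emptyCut ⟩
  R2    : ∀ {A B} → (A · B) ⊢ A
  E¬    : ∀ {A} → ⟨ A ⇒ emptyCut ⟩ ⊢ cut A
  MPi   : ∀ {A B} → (A · ⟨ A ⇒ B ⟩) ⊢ B
  E⊥    : ∀ {A} → emptyCut ⊢ A
  R8i   : ∀ {A B C} → (A · B) ⊢ C → A ⊢ ⟨ B ⇒ C ⟩
  R0    : ∀ {A B C} → A ⊢ B → A ⊢ C → A ⊢ (B · C)
  E∨    : ∀ {A B C} → A ⊢ C → B ⊢ C → ⟨ A ∨ B ⟩ ⊢ C

-- By disjunction elimination it suffices to derive ⟨ [A] ⇒ B ⟩ from each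
-- disjunct: from A, because A together with [A] yields the empty cut and hence
-- anything (ex falso); from B, because B may always be weakened to ⟨ C ⇒ B ⟩.
module Submission where

open import Defs

infixr 5 _⨾_

_⨾_ : ∀ {A B C} → A ⊢ B → B ⊢ C → A ⊢ C
_⨾_ = trans

R2ʳ : ∀ {A B} → A · B ⊢ B
R2ʳ = same ·-comm ⨾ R2

cut-explosion : ∀ {A C} → A · cut A ⊢ C
cut-explosion = R0 R2 (R2ʳ ⨾ I¬) ⨾ MPi ⨾ E⊥

⇒-cut-intro : ∀ A B → A ⊢ ⟨ cut A ⇒ B ⟩
⇒-cut-intro A B = R8i cut-explosion

⇒-weaken : ∀ A B → B ⊢ ⟨ A ⇒ B ⟩
⇒-weaken A B = R8i R2

mainTheorem11 : (A B : Graph) → ⟨ A ∨ B ⟩ ⊢ ⟨ cut A ⇒ B ⟩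
mainTheorem11 A B = E∨ (⇒-cut-intro A B) (⇒-weaken (cut A) B)
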